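{- Let $n \geq 2$ and $k \geq 2$ be integers with $k \geq 2n-3+\left\lfloor \frac{n-1}{4}\right\rfloor$. Suppose $k = a_1+a_2+\cdots+a_t$ where $a_1,\dots,a_t$ are integers with $n-1 \geq a_1 \geq a_2 \geq \cdots \geq a_t \geq 1$. Then either there is a partition of $\{1,\dots,t\}$ into three parts $I_1,I_2,I_3$ such that $\sum_{i\in I_j} a_i \geq \left\lceil \frac{n}{4}\right\rceil$ for each $j=1,2,3$, or there is a partition of $\{1,\dots,t\}$ into two parts $I_1,I_2$ such that $\sum_{i\in I_j} a_i \geq n-2$ for each $j=1,2$.
   Context: "Combining $a_1,\dots,a_t$ into parts" means partitioning the multiset of summands into groups and taking the sum of each group; the statement above expresses this via a partition of the index set. -}

module Defs where

open import Data.Nat using (ℕ; zero; suc; _+_; _∸_; _≤_)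
open import Data.Nat.DivMod using (_/_)
open import Data.Fin using (Fin; _≟_)
open import Data.Fin.Properties using ()
open import Data.Vec.Functional using (Vector)
open import Relation.Nullary using (yes; no)
open import Data.Product using (∃)
open import Relation.Binary.PropositionalEquality using (_≡_)

∑ : {t : ℕ} → (Fin t → ℕ) → ℕ
∑ {zero} a = 0
∑ {suc t} a = a Fin.zero + ∑ {t} (λ i → a (Fin.suc i))
  where import Data.Fin as Fin

partSum : {t m : ℕ} → (Fin t → ℕ) → (Fin t → Fin m) → Fin m → ℕ
partSum {t} a f j = ∑ {t} (λ i → sel (f i ≟ j) (a i))
  where
  sel : ∀ {P : Set} → Relation.Nullary.Dec P → ℕ → ℕ
  sel (yes _) x = x
  sel (no _)  _ = 0
    where import Relation.Nullary

NonIncreasing : {t : ℕ} → (Fin t → ℕ) → Set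
NonIncreasing {t} a = ∀ (i j : Fin t) → i Data.Fin.≤ j → a j ≤ a i
  where import Data.Fin

-- a partition of {1..t} into m parts, given as a labelling f : Fin t → Fin m
-- with part I_j = f⁻¹(j); parts are required to be nonempty
Surjective : {t m : ℕ} → (Fin t → Fin m) → Set
Surjective {t} {m} f = ∀ (j : Fin m) → ∃ λ (i : Fin t) → f i ≡ j

floorDiv4 : ℕ → ℕ
floorDiv4 x = x / 4

ceilDiv4 : ℕ → ℕ
ceilDiv4 x = (x + 3) / 4

module Submission where

-- Partitions into consecutive blocks of the non-increasing sequence suffice; they are cut
-- where the prefix sums S cross suitable levels. Write n = m + 2 and ⌈n/4⌉ = f + 1, so
-- that k ≥ 2m + 1 + f and 3f ≤ m + 1. If a₁ ≥ m, then {a₁} and the rest are two parts of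
-- sum ≥ m. If a₁ < m and a₂ ≥ f + 1, then {a₁}, {a₂} and the rest work, the rest having sum
-- ≥ k − 2(m − 1). Otherwise all a_i with i ≥ 2 are at most f: cut where S first reaches
-- f + 1 and then where it first gains another f + 1. The first block has sum ≤ f + a₁ and
-- the second ≤ 2f, leaving k − 3f − a₁ ≥ m + 2 − 2f ≥ f + 1 for the third.

open import Defs
open import Data.Nat
  using (ℕ; zero; suc; _+_; _*_; _∸_; _≤_; _<_; _≥_; _≤′_; _≤?_; z≤n; s≤s; ≤′-refl; ≤′-step)
open import Data.Nat.Properties hiding (_≟_)
open import Data.Nat.DivMod using (_/_; m/n*n≤m; +-distrib-/-∣ʳ)
open import Data.Nat.Divisibility using (∣-refl)
open import Data.Nat.Tactic.RingSolver using (solve-∀)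
open import Data.Fin using (Fin; _≟_) renaming (zero to fz; suc to fs)
open import Data.Vec.Functional using (tail)
open import Data.Product using (_×_; ∃; ∃₂; _,_; proj₁; proj₂)
open import Data.Sum using (_⊎_; inj₁; inj₂)
import Data.Sum as Sum
open import Data.Empty using (⊥-elim)
open import Relation.Nullary using (yes; no)
open import Relation.Binary.Core using (_Preserves_⟶_)
open import Relation.Binary.PropositionalEquality
open import Algebra.Properties.CommutativeSemigroup +-commutativeSemigroup using (x∙yz≈y∙xz)
open import Algebra.Properties.CommutativeMonoid.Sum +-0-commutativeMonoid
  using (sum; sum-cong-≗; sum-replicate-zero) renaming (∑-distrib-+ to sum-distrib-+)

∑≡sum : ∀ {t} (g : Fin t → ℕ) → ∑ g ≡ sum g
∑≡sum {zero} g = refl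
∑≡sum {suc t} g = cong (g fz +_) (∑≡sum (tail g))

∑-zero : ∀ t → ∑ {t} (λ _ → 0) ≡ 0
∑-zero t = trans (∑≡sum {t} (λ _ → 0)) (sum-replicate-zero t)

∑-distrib-+ : ∀ {t} (g h : Fin t → ℕ) → ∑ (λ i → g i + h i) ≡ ∑ g + ∑ h
∑-distrib-+ g h =
  trans (∑≡sum (λ i → g i + h i)) (trans (sum-distrib-+ g h) (sym (cong₂ _+_ (∑≡sum g) (∑≡sum h))))

∑-cong : ∀ {t} {g h : Fin t → ℕ} → (∀ i → g i ≡ h i) → ∑ g ≡ ∑ h
∑-cong {g = g} {h} g≗h = trans (∑≡sum g) (trans (sum-cong-≗ g≗h) (sym (∑≡sum h)))

-- partSum {1} (λ _ → x) (λ _ → l) j is x if l ≡ j and 0 otherwise: it stands in for the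
-- selector local to partSum.
partSum-suc : ∀ {t m} (a : Fin (suc t) → ℕ) (f : Fin (suc t) → Fin m) j →
  partSum a f j ≡ partSum {1} (λ _ → a fz) (λ _ → f fz) j + partSum (tail a) (tail f) j
partSum-suc a f j = cong (_+ partSum (tail a) (tail f) j) (sym (+-identityʳ _))

partSum-one-fs : ∀ {m} x (l j : Fin m) →
  partSum {1} (λ _ → x) (λ _ → fs l) (fs j) ≡ partSum {1} (λ _ → x) (λ _ → l) j
partSum-one-fs x l j with l ≟ j
... | yes _ = refl
... | no _ = refl

∑-partSum-one : ∀ {m} x (l : Fin m) → ∑ (partSum {1} (λ _ → x) (λ _ → l)) ≡ x + 0
∑-partSum-one {suc m} x fz = trans (cong (x + 0 +_) (∑-zero m)) (+-identityʳ (x + 0))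
∑-partSum-one {suc m} x (fs l) = trans (∑-cong (partSum-one-fs x l)) (∑-partSum-one x l)

∑-partSum : ∀ {t m} (a : Fin t → ℕ) (f : Fin t → Fin m) → ∑ (partSum a f) ≡ ∑ a
∑-partSum {zero} {m} a f = ∑-zero m
∑-partSum {suc t} {m} a f = begin
  ∑ (partSum a f)                                     ≡⟨ ∑-cong (partSum-suc a f) ⟩
  ∑ (λ j → first j + partSum (tail a) (tail f) j)     ≡⟨ ∑-distrib-+ first (partSum (tail a) (tail f)) ⟩
  ∑ first + ∑ (partSum (tail a) (tail f))
    ≡⟨ cong₂ _+_ (∑-partSum-one (a fz) (f fz)) (∑-partSum (tail a) (tail f)) ⟩
  a fz + 0 + ∑ (tail a)                               ≡⟨ cong (_+ ∑ (tail a)) (+-identityʳ (a fz)) ⟩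
  ∑ a                                                 ∎
  where
  open ≡-Reasoning
  first : Fin m → ℕ
  first = partSum {1} (λ _ → a fz) (λ _ → f fz)

part-nonempty : ∀ {t m} (a : Fin t → ℕ) (f : Fin t → Fin m) j → 0 < partSum a f j → ∃ λ i → f i ≡ j
part-nonempty {suc t} a f j pos with f fz ≟ j
... | yes fz∈j = fz , fz∈j
... | no _ with part-nonempty (tail a) (tail f) j pos
...   | i , i∈j = fs i , i∈j

prefixSum : (ℕ → ℕ) → ℕ → ℕ
prefixSum A zero = 0
prefixSum A (suc p) = prefixSum A p + A p

prefixSum-suc : ∀ (A : ℕ → ℕ) p → prefixSum A (suc p) ≡ A 0 + prefixSum (λ i → A (suc i)) p
prefixSum-suc A zero = +-comm 0 (A 0)
prefixSum-suc A (suc p) = trans (cong (_+ A (suc p)) (prefixSum-suc A p)) (+-assoc (A 0) _ _)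

prefixSum-zero : ∀ p → prefixSum (λ _ → 0) p ≡ 0
prefixSum-zero zero = refl
prefixSum-zero (suc p) = trans (+-identityʳ _) (prefixSum-zero p)

prefixSum-mono : ∀ (A : ℕ → ℕ) → prefixSum A Preserves _≤_ ⟶ _≤_
prefixSum-mono A p≤q = go (≤⇒≤′ p≤q)
  where
  go : ∀ {p q} → p ≤′ q → prefixSum A p ≤ prefixSum A q
  go ≤′-refl = ≤-refl
  go (≤′-step p≤′q) = ≤-trans (go p≤′q) (m≤m+n _ _)

pad : ∀ {t} → (Fin t → ℕ) → ℕ → ℕ
pad {zero} a _ = 0
pad {suc t} a zero = a fz
pad {suc t} a (suc i) = pad (tail a) i

prefixSum-pad : ∀ {t} (a : Fin t → ℕ) → prefixSum (pad a) t ≡ ∑ a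
prefixSum-pad {zero} a = refl
prefixSum-pad {suc t} a = trans (prefixSum-suc (pad a) t) (cong (a fz +_) (prefixSum-pad (tail a)))

NonIncreasing-tail : ∀ {t} {a : Fin (suc t) → ℕ} → NonIncreasing a → NonIncreasing (tail a)
NonIncreasing-tail anti i j i≤j = anti (fs i) (fs j) (s≤s i≤j)

pad-≤-head : ∀ {t} {a : Fin (suc t) → ℕ} → NonIncreasing a → ∀ j → pad a j ≤ a fz
pad-≤-head anti zero = ≤-refl
pad-≤-head {zero} anti (suc j) = z≤n
pad-≤-head {suc t} anti (suc j) = ≤-trans (pad-≤-head (NonIncreasing-tail anti) j) (anti fz (fs fz) z≤n)

pad-nonincreasing : ∀ {t} {a : Fin t → ℕ} → NonIncreasing a → pad a Preserves _≤_ ⟶ _≥_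
pad-nonincreasing {zero} _ _ = z≤n
pad-nonincreasing {suc t} anti {zero} {j} _ = pad-≤-head anti j
pad-nonincreasing {suc t} anti {suc i} {suc j} (s≤s i≤j) = pad-nonincreasing (NonIncreasing-tail anti) i≤j

threeBlocks : ∀ {t} → ℕ → ℕ → Fin t → Fin 3
threeBlocks (suc p) r fz = fz
threeBlocks (suc p) r (fs i) = threeBlocks p r i
threeBlocks zero (suc r) fz = fs fz
threeBlocks zero (suc r) (fs i) = threeBlocks zero r i
threeBlocks zero zero _ = fs (fs fz)

twoBlocks : ∀ {t} → ℕ → Fin t → Fin 2
twoBlocks (suc p) fz = fz
twoBlocks (suc p) (fs i) = twoBlocks p i
twoBlocks zero _ = fs fz

module _ where
  open ≡-Reasoning

  partSum-threeBlocks₀ : ∀ {t} (a : Fin t → ℕ) p r → partSum a (threeBlocks p r) fz ≡ prefixSum (pad a) p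
  partSum-threeBlocks₀ {zero} a p r = sym (prefixSum-zero p)
  partSum-threeBlocks₀ {suc t} a (suc p) r = begin
    a fz + partSum (tail a) (threeBlocks p r) fz ≡⟨ cong (a fz +_) (partSum-threeBlocks₀ (tail a) p r) ⟩
    a fz + prefixSum (pad (tail a)) p            ≡⟨ prefixSum-suc (pad a) p ⟨
    prefixSum (pad a) (suc p)                    ∎
  partSum-threeBlocks₀ {suc t} a zero (suc r) = partSum-threeBlocks₀ (tail a) zero r
  partSum-threeBlocks₀ {suc t} a zero zero = partSum-threeBlocks₀ (tail a) zero zero

  partSum-threeBlocks₀₁ : ∀ {t} (a : Fin t → ℕ) p r →
    partSum a (threeBlocks p r) fz + partSum a (threeBlocks p r) (fs fz) ≡ prefixSum (pad a) (p + r)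
  partSum-threeBlocks₀₁ {zero} a p r = sym (prefixSum-zero (p + r))
  partSum-threeBlocks₀₁ {suc t} a (suc p) r = begin
    a fz + P₀ + P₁                            ≡⟨ +-assoc (a fz) P₀ P₁ ⟩
    a fz + (P₀ + P₁)                          ≡⟨ cong (a fz +_) (partSum-threeBlocks₀₁ (tail a) p r) ⟩
    a fz + prefixSum (pad (tail a)) (p + r)   ≡⟨ prefixSum-suc (pad a) (p + r) ⟨
    prefixSum (pad a) (suc p + r)             ∎
    where
    P₀ P₁ : ℕ
    P₀ = partSum (tail a) (threeBlocks p r) fz
    P₁ = partSum (tail a) (threeBlocks p r) (fs fz)
  partSum-threeBlocks₀₁ {suc t} a zero (suc r) = begin
    P₀ + (a fz + P₁)                          ≡⟨ x∙yz≈y∙xz P₀ (a fz) P₁ ⟩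
    a fz + (P₀ + P₁)                          ≡⟨ cong (a fz +_) (partSum-threeBlocks₀₁ (tail a) zero r) ⟩
    a fz + prefixSum (pad (tail a)) r         ≡⟨ prefixSum-suc (pad a) r ⟨
    prefixSum (pad a) (suc r)                 ∎
    where
    P₀ P₁ : ℕ
    P₀ = partSum (tail a) (threeBlocks zero r) fz
    P₁ = partSum (tail a) (threeBlocks zero r) (fs fz)
  partSum-threeBlocks₀₁ {suc t} a zero zero = partSum-threeBlocks₀₁ (tail a) zero zero

  partSum-twoBlocks₀ : ∀ {t} (a : Fin t → ℕ) p → partSum a (twoBlocks p) fz ≡ prefixSum (pad a) p
  partSum-twoBlocks₀ {zero} a p = sym (prefixSum-zero p)
  partSum-twoBlocks₀ {suc t} a (suc p) = begin
    a fz + partSum (tail a) (twoBlocks p) fz ≡⟨ cong (a fz +_) (partSum-twoBlocks₀ (tail a) p) ⟩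
    a fz + prefixSum (pad (tail a)) p        ≡⟨ prefixSum-suc (pad a) p ⟨
    prefixSum (pad a) (suc p)                ∎
  partSum-twoBlocks₀ {suc t} a zero = partSum-twoBlocks₀ (tail a) zero

Crossing : (ℕ → ℕ) → ℕ → ℕ → Set
Crossing g v s = ∃ λ p → s ≤ p × g p < v × v ≤ g (suc p)

crossing : ∀ (g : ℕ → ℕ) {v} s d → g s < v → v ≤ g (d + s) → Crossing g v s
crossing g s zero gs<v v≤gs = ⊥-elim (<⇒≱ gs<v v≤gs)
crossing g {v} s (suc d) gs<v v≤g with v ≤? g (d + s)
... | yes v≤ = crossing g s d gs<v v≤
... | no v≰ = d + s , m≤n+m s d , ≰⇒> v≰ , v≤g

-- The blocks [0, p), [p, q) and [q, …) have sums S p, S q − S p and k − S q.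
ThreeWaySplit : (ℕ → ℕ) → ℕ → ℕ → Set
ThreeWaySplit A k c = ∃₂ λ p q → p ≤ q × c ≤ S p × S p + c ≤ S q × S q + c ≤ k
  where
  S : ℕ → ℕ
  S = prefixSum A

TwoWaySplit : (ℕ → ℕ) → ℕ → ℕ → Set
TwoWaySplit A k c = ∃ λ p → c ≤ S p × S p + c ≤ k × 0 < S p × S p < k
  where
  S : ℕ → ℕ
  S = prefixSum A

greedy-split : ∀ {m f k t} (A : ℕ → ℕ) → suc (m + m + f) ≤ k → 3 * f ≤ suc m → prefixSum A t ≡ k
  → A Preserves _≤_ ⟶ _≥_ → A 0 < m → A 1 ≤ f → ThreeWaySplit A k (suc f)
greedy-split {m} {f} {k} {t} A 2m+1+f≤k 3f≤1+m S≡k anti x<m y≤f =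
  firstCut (crossing S 0 t (s≤s z≤n) (reaches c≤k 0))
  where
  open ≤-Reasoning
  S : ℕ → ℕ
  S = prefixSum A
  c : ℕ
  c = suc f
  reaches : ∀ {v} → v ≤ k → ∀ s → v ≤ S (t + s)
  reaches v≤k s = ≤-trans v≤k (≤-trans (≤-reflexive (sym S≡k)) (prefixSum-mono A (m≤m+n t s)))
  c≤k : c ≤ k
  c≤k = ≤-trans (s≤s (m≤n+m f (m + m))) 2m+1+f≤k
  absorb : ∀ {u} → u ≤ suc m → u + A 0 ≤ m + m
  absorb {u} u≤1+m = begin
    u + A 0       ≤⟨ +-monoˡ-≤ (A 0) u≤1+m ⟩
    suc m + A 0   ≡⟨ +-suc m (A 0) ⟨
    m + suc (A 0) ≤⟨ +-monoʳ-≤ m x<m ⟩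
    m + m         ∎
  firstCut : Crossing S c 0 → ThreeWaySplit A k c
  firstCut (p₀ , _ , Sp₀<c , c≤Sp₁) =
    secondCut (crossing S (suc p₀) t (m<m+n (S (suc p₀)) (s≤s z≤n)) (reaches Sp₁+c≤k (suc p₀)))
    where
    Sp₁≤f+x : S (suc p₀) ≤ f + A 0
    Sp₁≤f+x = +-mono-≤ (≤-pred Sp₀<c) (anti z≤n)
    Sp₁+c≤k : S (suc p₀) + c ≤ k
    Sp₁+c≤k = begin
      S (suc p₀) + c    ≤⟨ +-monoˡ-≤ c Sp₁≤f+x ⟩
      f + A 0 + suc f   ≡⟨ +-suc (f + A 0) f ⟩
      suc (f + A 0 + f) ≤⟨ s≤s (+-monoˡ-≤ f (absorb (≤-trans (m≤m+n f _) 3f≤1+m))) ⟩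
      suc (m + m + f)   ≤⟨ 2m+1+f≤k ⟩
      k                 ∎
    secondCut : Crossing S (S (suc p₀) + c) (suc p₀) → ThreeWaySplit A k c
    secondCut (q₀ , p₁≤q₀ , Sq₀< , Sp₁+c≤Sq₁) =
      suc p₀ , suc q₀ , m≤n⇒m≤1+n p₁≤q₀ , c≤Sp₁ , Sp₁+c≤Sq₁ , Sq₁+c≤k
      where
      regroup : ∀ f x → f + x + f + f + suc f ≡ suc (3 * f + x + f)
      regroup = solve-∀
      Sq₀≤Sp₁+f : S q₀ ≤ S (suc p₀) + f
      Sq₀≤Sp₁+f = ≤-pred (subst (S q₀ <_) (+-suc (S (suc p₀)) f) Sq₀<)
      Aq₀≤f : A q₀ ≤ f
      Aq₀≤f = ≤-trans (anti (≤-trans (s≤s z≤n) p₁≤q₀)) y≤f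
      Sq₁+c≤k : S (suc q₀) + c ≤ k
      Sq₁+c≤k = begin
        S q₀ + A q₀ + c              ≤⟨ +-monoˡ-≤ c (+-mono-≤ Sq₀≤Sp₁+f Aq₀≤f) ⟩
        S (suc p₀) + f + f + c       ≤⟨ +-monoˡ-≤ c (+-monoˡ-≤ f (+-monoˡ-≤ f Sp₁≤f+x)) ⟩
        f + A 0 + f + f + suc f      ≡⟨ regroup f (A 0) ⟩
        suc (3 * f + A 0 + f)        ≤⟨ s≤s (+-monoˡ-≤ f (absorb 3f≤1+m)) ⟩
        suc (m + m + f)              ≤⟨ 2m+1+f≤k ⟩
        k                            ∎

prefixSum-split : ∀ {m f k t} (A : ℕ → ℕ) → 2 ≤ k → suc (m + m + f) ≤ k → 3 * f ≤ suc m
  → prefixSum A t ≡ k → A Preserves _≤_ ⟶ _≥_ → 0 < A 0 → A 0 ≤ suc m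
  → ThreeWaySplit A k (suc f) ⊎ TwoWaySplit A k m
prefixSum-split {m} {f} {k} {t} A 2≤k 2m+1+f≤k 3f≤1+m S≡k anti x>0 x≤1+m with m ≤? A 0 | suc f ≤? A 1
... | yes m≤x | _ = inj₂ (1 , m≤x , x+m≤k , x>0 , x<k x≤1+m x+m≤k)
  where
  open ≤-Reasoning
  x+m≤k : A 0 + m ≤ k
  x+m≤k = begin
    A 0 + m           ≤⟨ +-monoˡ-≤ m x≤1+m ⟩
    suc (m + m)       ≤⟨ s≤s (m≤m+n (m + m) f) ⟩
    suc (m + m + f)   ≤⟨ 2m+1+f≤k ⟩
    k                 ∎
  x<k : ∀ {n} → A 0 ≤ suc n → A 0 + n ≤ k → A 0 < k
  x<k {zero} x≤1 _ = ≤-trans (s≤s x≤1) 2≤k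
  x<k {suc n} _ x+n≤k = ≤-trans (m<m+n (A 0) (s≤s z≤n)) x+n≤k
... | no m≰x | yes c≤y = inj₁ (1 , 2 , s≤s z≤n , ≤-trans c≤y (anti z≤n) , +-monoʳ-≤ (A 0) c≤y , x+y+c≤k)
  where
  open ≤-Reasoning
  x≤m : A 0 ≤ m
  x≤m = <⇒≤ (≰⇒> m≰x)
  x+y+c≤k : A 0 + A 1 + suc f ≤ k
  x+y+c≤k = begin
    A 0 + A 1 + suc f   ≤⟨ +-monoˡ-≤ (suc f) (+-mono-≤ x≤m (≤-trans (anti z≤n) x≤m)) ⟩
    m + m + suc f       ≡⟨ +-suc (m + m) f ⟩
    suc (m + m + f)     ≤⟨ 2m+1+f≤k ⟩
    k                   ∎
... | no m≰x | no c≰y =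
  inj₁ (greedy-split {t = t} A 2m+1+f≤k 3f≤1+m S≡k anti (≰⇒> m≰x) (≤-pred (≰⇒> c≰y)))

ThreeWaySplit⇒partition : ∀ {t k c} (a : Fin t → ℕ) → ∑ a ≡ k → ThreeWaySplit (pad a) k (suc c)
  → ∃ λ (f : Fin t → Fin 3) → Surjective f × (∀ j → suc c ≤ partSum a f j)
ThreeWaySplit⇒partition {t} {k} {c} a ∑a≡k (p , q , p≤q , c≤Sp , Sp+c≤Sq , Sq+c≤k) =
  f , (λ j → part-nonempty a f j (≤-trans (s≤s z≤n) (large j))) , large
  where
  open ≡-Reasoning
  S : ℕ → ℕ
  S = prefixSum (pad a)
  f : Fin t → Fin 3
  f = threeBlocks p (q ∸ p)
  P : Fin 3 → ℕ
  P = partSum a f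
  P₀≡Sp : P fz ≡ S p
  P₀≡Sp = partSum-threeBlocks₀ a p (q ∸ p)
  P₀₁≡Sq : P fz + P (fs fz) ≡ S q
  P₀₁≡Sq = trans (partSum-threeBlocks₀₁ a p (q ∸ p)) (cong S (m+[n∸m]≡n p≤q))
  Sq+P₂≡k : S q + P (fs (fs fz)) ≡ k
  Sq+P₂≡k = begin
    S q + P₂                    ≡⟨ cong (_+ P₂) P₀₁≡Sq ⟨
    P fz + P (fs fz) + P₂       ≡⟨ +-assoc (P fz) (P (fs fz)) P₂ ⟩
    P fz + (P (fs fz) + P₂)     ≡⟨ cong (λ x → P fz + (P (fs fz) + x)) (+-identityʳ P₂) ⟨
    ∑ P                         ≡⟨ ∑-partSum a f ⟩
    ∑ a                         ≡⟨ ∑a≡k ⟩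
    k                           ∎
    where
    P₂ : ℕ
    P₂ = P (fs (fs fz))
  large : ∀ j → suc c ≤ P j
  large fz = subst (suc c ≤_) (sym P₀≡Sp) c≤Sp
  large (fs fz) =
    +-cancelˡ-≤ (P fz) (suc c) _ (subst₂ (λ x y → x + suc c ≤ y) (sym P₀≡Sp) (sym P₀₁≡Sq) Sp+c≤Sq)
  large (fs (fs fz)) = +-cancelˡ-≤ (S q) (suc c) _ (subst (S q + suc c ≤_) (sym Sq+P₂≡k) Sq+c≤k)

TwoWaySplit⇒partition : ∀ {t k c} (a : Fin t → ℕ) → ∑ a ≡ k → TwoWaySplit (pad a) k c
  → ∃ λ (g : Fin t → Fin 2) → Surjective g × (∀ j → c ≤ partSum a g j)
TwoWaySplit⇒partition {t} {k} {c} a ∑a≡k (p , c≤Sp , Sp+c≤k , Sp>0 , Sp<k) =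
  g , (λ j → part-nonempty a g j (positive j)) , large
  where
  open ≡-Reasoning
  S : ℕ → ℕ
  S = prefixSum (pad a)
  g : Fin t → Fin 2
  g = twoBlocks p
  P : Fin 2 → ℕ
  P = partSum a g
  P₀≡Sp : P fz ≡ S p
  P₀≡Sp = partSum-twoBlocks₀ a p
  Sp+P₁≡k : S p + P (fs fz) ≡ k
  Sp+P₁≡k = begin
    S p + P (fs fz)   ≡⟨ cong₂ _+_ P₀≡Sp (+-identityʳ (P (fs fz))) ⟨
    ∑ P               ≡⟨ ∑-partSum a g ⟩
    ∑ a               ≡⟨ ∑a≡k ⟩
    k                 ∎
  large : ∀ j → c ≤ P j
  large fz = subst (c ≤_) (sym P₀≡Sp) c≤Sp
  large (fs fz) = +-cancelˡ-≤ (S p) c _ (subst (S p + c ≤_) (sym Sp+P₁≡k) Sp+c≤k)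
  positive : ∀ j → 0 < P j
  positive fz = subst (0 <_) (sym P₀≡Sp) Sp>0
  positive (fs fz) = +-cancelˡ-≤ (S p) 1 _ (subst₂ _≤_ (+-comm 1 (S p)) (sym Sp+P₁≡k) Sp<k)

ceilDiv4-suc : ∀ n → ceilDiv4 (suc n) ≡ suc (floorDiv4 n)
ceilDiv4-suc n = begin
  (suc n + 3) / 4   ≡⟨ cong (_/ 4) (+-suc n 3) ⟨
  (n + 4) / 4       ≡⟨ +-distrib-/-∣ʳ n (∣-refl {4}) ⟩
  n / 4 + 1         ≡⟨ +-comm (n / 4) 1 ⟩
  suc (n / 4)       ∎
  where open ≡-Reasoning

3*floorDiv4≤ : ∀ n → 3 * floorDiv4 n ≤ n
3*floorDiv4≤ n = begin
  3 * (n / 4)   ≤⟨ *-monoˡ-≤ (n / 4) (n≤1+n 3) ⟩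
  4 * (n / 4)   ≡⟨ *-comm 4 (n / 4) ⟩
  n / 4 * 4     ≤⟨ m/n*n≤m n 4 ⟩
  n             ∎
  where open ≤-Reasoning

lemma2p1 : (n k t : ℕ) → 2 ≤ n → 2 ≤ k
    → (2 * n ∸ 3) + floorDiv4 (n ∸ 1) ≤ k
    → (a : Fin t → ℕ) → ∑ a ≡ k → NonIncreasing a
    → (∀ i → 1 ≤ a i × a i ≤ n ∸ 1)
    → (∃ λ (f : Fin t → Fin 3) → Surjective f × (∀ j → ceilDiv4 n ≤ partSum a f j))
      ⊎ (∃ λ (g : Fin t → Fin 2) → Surjective g × (∀ j → n ∸ 2 ≤ partSum a g j))
lemma2p1 zero _ _ () _ _ _ _ _ _
lemma2p1 (suc zero) _ _ (s≤s ()) _ _ _ _ _ _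
lemma2p1 (suc (suc m)) .0 zero _ () _ a refl _ _
lemma2p1 (suc (suc m)) k (suc t) _ 2≤k bound a ∑a≡k anti range rewrite ceilDiv4-suc (suc m) =
  Sum.map (ThreeWaySplit⇒partition a ∑a≡k) (TwoWaySplit⇒partition a ∑a≡k)
    (prefixSum-split {t = suc t} (pad a) 2≤k 2m+1+f≤k (3*floorDiv4≤ (suc m)) (trans (prefixSum-pad a) ∑a≡k)
      (pad-nonincreasing anti) (proj₁ (range fz)) (proj₂ (range fz)))
  where
  double : ∀ m → 2 * suc (suc m) ≡ 3 + suc (m + m)
  double = solve-∀
  2m+1+f≤k : suc (m + m + floorDiv4 (suc m)) ≤ k
  2m+1+f≤k = subst (λ x → x + floorDiv4 (suc m) ≤ k) (trans (cong (_∸ 3) (double m)) (m+n∸m≡n 3 _)) bound
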